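{- For a permutation $\pi=\pi_1\cdots\pi_n$ of $[n]=\{1,\dots,n\}$, call position $i$ a left-to-right minimum if $\pi_i<\pi_j$ for all $j<i$. Given $p\ge1$, let $\pi$ define a play of the following game with players $1,\dots,p$ lined up in this order: for $i=1,2,\dots$, the $i$th throw is made by the player at the front of the line; if $i$ is a left-to-right minimum of $\pi$ the player moves to the back of the line, otherwise the player is eliminated. Say $\pi\in S_n$ encodes a complete $p$-player game won by player $k$ if, when this is carried out for $i=1,\dots,n$, the $n$th throw is the one after which exactly one player remains (equivalently, $\pi$ has exactly $p-1$ positions that are not left-to-right minima and position $n$ is one of them), and the remaining player is $k$. Let $\mathcal W_{n,p,k}$ be the set of such permutations in $S_n$, and for $1\le s\le n$ let $w_{n,p,k,s}$ be the number of $\pi\in\mathcal W_{n,p,k}$ with $\pi_1=s$. Then $w_{n,p,k,s}=0$ whenever $p=1$ or $n=2$, except $w_{2,2,1,1}=1$; and for $n\ge3$, $p\ge2$, $1\le k\le p$, $1\le s\le n$, $$w_{n,p,k,s}=\sum_{s'=1}^{s-1}w_{n-1,p,\overline{k-1},s'}+(n-s)\,w_{n-1,p-1,\hat k,s},$$ where $\overline{k-1}\in[p]$ is the element congruent to $k-1$ modulo $p$, $\hat k=k-1$ for $k\ge3$, $\hat k=1$ for $k=1$, and for $k=2$ the second summand is omitted.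
   Context: Here $n\ge2$ is understood throughout (with $w_{n,p,k,s}$ defined for $n\ge 2$, $p\ge1$, $1\le k\le p$, $1\le s\le n$). -}

module Defs where

open import Data.Nat using (ℕ; zero; suc; _+_; _*_; _∸_; _<ᵇ_; _≡ᵇ_; _≤ᵇ_)
open import Data.Bool using (Bool; true; false; not; _∧_; _∨_; if_then_else_)
open import Data.Fin using (Fin; toℕ)
open import Data.Vec using (Vec; []; _∷_; lookup; toList)
open import Data.List using (List; []; _∷_; _++_; map; concatMap; allFin; take; length; upTo; applyUpTo)
open import Data.Nat.ListAction using (sum)

all : {A : Set} → (A → Bool) → List A → Bool
all P [] = true
all P (x ∷ xs) = P x ∧ all P xs

-- The entry
-- x : Fin n stands for the value toℕ x + 1 ∈ [n]; position i : Fin n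
-- stands for position toℕ i + 1.

allVecs : (n m : ℕ) → List (Vec (Fin n) m)
allVecs n zero = [] ∷ []
allVecs n (suc m) = concatMap (λ x → map (x ∷_) (allVecs n m)) (allFin n)

_==ᶠ_ : {n : ℕ} → Fin n → Fin n → Bool
x ==ᶠ y = toℕ x ≡ᵇ toℕ y

isPerm : {n : ℕ} → Vec (Fin n) n → Bool
isPerm {n} π = all (λ i → all (λ j → (i ==ᶠ j) ∨ not (lookup π i ==ᶠ lookup π j)) (allFin n)) (allFin n)

perms : (n : ℕ) → List (Vec (Fin n) n)
perms n = go (allVecs n n)
  where
  go : List (Vec (Fin n) n) → List (Vec (Fin n) n)
  go [] = []
  go (π ∷ πs) = if isPerm π then π ∷ go πs else go πs

isLRMin : {n : ℕ} → Vec (Fin n) n → Fin n → Bool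
isLRMin {n} π i =
  all (λ j → not (toℕ j <ᵇ toℕ i) ∨ (toℕ (lookup π i) <ᵇ toℕ (lookup π j))) (allFin n)

throw : List ℕ → Bool → List ℕ
throw [] b = []
throw (x ∷ q) true = q ++ (x ∷ [])
throw (x ∷ q) false = q

play : List ℕ → List Bool → List ℕ
play q [] = q
play q (b ∷ bs) = play (throw q b) bs

lineAfter : {n : ℕ} → (p : ℕ) → Vec (Fin n) n → ℕ → List ℕ
lineAfter {n} p π m = play (applyUpTo suc p) (take m (map (isLRMin π) (allFin n)))

onlyPlayer : ℕ → List ℕ → Bool
onlyPlayer k (x ∷ []) = x ≡ᵇ k
onlyPlayer k _ = false

-- π encodes a complete p-player game won by player k: before the nth
-- throw (i.e. after throws 0,…,n-1) at least two players remain, and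
-- after the nth throw exactly one player remains, namely k.
wonBy : {n : ℕ} → (p k : ℕ) → Vec (Fin n) n → Bool
wonBy {n} p k π =
  all (λ m → 2 ≤ᵇ length (lineAfter p π m)) (upTo n) ∧ onlyPlayer k (lineAfter p π n)

firstIs : {n : ℕ} → ℕ → Vec (Fin n) n → Bool
firstIs s [] = false
firstIs s (x ∷ _) = suc (toℕ x) ≡ᵇ s

count : {A : Set} → (A → Bool) → List A → ℕ
count P [] = 0
count P (x ∷ xs) = if P x then suc (count P xs) else count P xs

w : ℕ → ℕ → ℕ → ℕ → ℕ
w n p k s = count (λ π → wonBy p k π ∧ firstIs s π) (perms n)

kbar : ℕ → ℕ → ℕ
kbar p 1 = p
kbar p k = k ∸ 1

secondTerm : ℕ → ℕ → ℕ → ℕ → ℕ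
secondTerm n p 0 s = 0
secondTerm n p 1 s = (n ∸ s) * w (n ∸ 1) (p ∸ 1) 1 s
secondTerm n p 2 s = 0
secondTerm n p (suc (suc (suc j))) s = (n ∸ s) * w (n ∸ 1) (p ∸ 1) (suc (suc j)) s

sumTo : ℕ → (ℕ → ℕ) → ℕ
sumTo s f = sum (applyUpTo (λ i → f (suc i)) (s ∸ 1))

{-# OPTIONS --safe #-}
-- Position 1 of π is always a left-to-right minimum, so the first thrower always survives;
-- what happens next depends on π₂.  If π₂ < π₁ = s, position 2 is again a minimum, the line
-- after the first throw is 2,…,p,1, and deleting π₁ leaves (after standardisation) a game
-- starting with π₂ in which player k appears under the label \overline{k-1}.  If π₂ > s,
-- player 2 is eliminated, the later minima are those of π with π₂ deleted, and relabelling the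
-- line 1,3,…,p as 1,…,p-1 turns player k into k̂ (player 2 can no longer win); each of the
-- n − s values π₂ > s gives the same count.
module Submission where

open import Defs
open import Data.Bool using (Bool; true; false; not; _∧_; _∨_; if_then_else_; T)
open import Data.Bool.Properties using (∧-assoc; ∧-idem; ∧-zeroʳ; ∧-identityʳ; ∨-comm)
open import Data.Empty using (⊥-elim)
open import Data.Fin as Fin using (Fin; zero; suc; toℕ; punchIn)
open import Data.Fin.Properties using (toℕ-injective; punchIn-injective; punchInᵢ≢i; 0≢1+n)
  renaming (suc-injective to fsuc-injective)
open import Data.List
  using (List; []; _∷_; _++_; _∷ʳ_; filterᵇ; map; concatMap; allFin; take; length; upTo; applyUpTo; tabulate)
open import Data.List.Properties
  using (map-++; length-++; length-map; length-tabulate; applyUpTo-∷ʳ; map-tabulate; tabulate-cong)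
open import Data.Nat using (ℕ; zero; suc; _+_; _*_; _∸_; _≤_; _<_; _<ᵇ_; _≡ᵇ_; _≤ᵇ_; z≤n; s≤s)
open import Data.Nat.ListAction using (sum)
open import Data.Nat.Properties
  using (+-0-commutativeMonoid; ≡ᵇ⇒≡; ≡⇒≡ᵇ; <ᵇ-reflects-<; +-assoc; +-comm; +-identityʳ; *-zeroʳ; n∸n≡0;
         suc-injective; ≤-refl; ≤-pred; <-trans; <-≤-trans; ≤⇒≯; <⇒≢; >⇒≢; m≤n⇒m<n∨m≡n)
open import Data.Product using (_×_; _,_; proj₁; proj₂)
open import Data.Sum using (_⊎_; inj₁; inj₂)
open import Data.Vec using (Vec; []; _∷_; lookup)
import Data.Vec as Vec
open import Function using (_∘_; id)
open import Function.Definitions using (Injective)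
open import Relation.Nullary using (¬_)
open import Relation.Nullary.Reflects
  using (Reflects; ofʸ; ofⁿ; fromEquivalence; det; ¬-reflects; _×-reflects_; _→-reflects_)
open import Relation.Binary.PropositionalEquality
open import Algebra.Properties.CommutativeMonoid.Sum +-0-commutativeMonoid
  using (sum-syntax; sum-cong-≗; sum-remove) renaming (sum to ∑)

open ≡-Reasoning

module _ {A : Set} where

  count-cong : {P Q : A → Bool} → (∀ x → P x ≡ Q x) → ∀ xs → count P xs ≡ count Q xs
  count-cong P≗Q [] = refl
  count-cong P≗Q (x ∷ xs) rewrite P≗Q x | count-cong P≗Q xs = refl

  count-all-false : {P : A → Bool} → (∀ x → P x ≡ false) → ∀ xs → count P xs ≡ 0
  count-all-false P≗false [] = refl
  count-all-false P≗false (x ∷ xs) rewrite P≗false x = count-all-false P≗false xs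

  count-++ : (P : A → Bool) (xs ys : List A) → count P (xs ++ ys) ≡ count P xs + count P ys
  count-++ P [] ys = refl
  count-++ P (x ∷ xs) ys with P x
  ... | true = cong suc (count-++ P xs ys)
  ... | false = count-++ P xs ys

  count-map : {B : Set} (P : B → Bool) (f : A → B) (xs : List A) →
    count P (map f xs) ≡ count (P ∘ f) xs
  count-map P f [] = refl
  count-map P f (x ∷ xs) with P (f x)
  ... | true = cong suc (count-map P f xs)
  ... | false = count-map P f xs

  count-concatMap-tabulate : {B : Set} {n : ℕ} (P : A → Bool) (g : B → List A) (f : Fin n → B) →
    count P (concatMap g (tabulate f)) ≡ ∑[ i < n ] count P (g (f i))
  count-concatMap-tabulate {n = zero} P g f = refl
  count-concatMap-tabulate {n = suc n} P g f =
    trans (count-++ P (g (f zero)) _)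
          (cong (count P (g (f zero)) +_) (count-concatMap-tabulate P g (f ∘ suc)))

  count-filterᵇ : (f P : A → Bool) (xs : List A) → count P (filterᵇ f xs) ≡ count (λ x → f x ∧ P x) xs
  count-filterᵇ f P [] = refl
  count-filterᵇ f P (x ∷ xs) with f x
  ... | true = cong (λ c → if P x then suc c else c) (count-filterᵇ f P xs)
  ... | false = count-filterᵇ f P xs

  filterᵇ-unique : (f : A → Bool) (g : List A → List A) → g [] ≡ [] →
    (∀ x xs → g (x ∷ xs) ≡ (if f x then x ∷ g xs else g xs)) → ∀ xs → g xs ≡ filterᵇ f xs
  filterᵇ-unique f g g[] g∷ [] = g[]
  filterᵇ-unique f g g[] g∷ (x ∷ xs) rewrite g∷ x xs | filterᵇ-unique f g g[] g∷ xs with f x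
  ... | true = refl
  ... | false = refl

count-allVecs-suc : ∀ n l (P : Vec (Fin n) (suc l) → Bool) →
  count P (allVecs n (suc l)) ≡ ∑[ x < n ] count (λ v → P (x ∷ v)) (allVecs n l)
count-allVecs-suc n l P =
  trans (count-concatMap-tabulate P (λ x → map (x ∷_) (allVecs n l)) id)
        (sum-cong-≗ (λ x → count-map P (x ∷_) (allVecs n l)))

∑-toℕ : ∀ n (f : ℕ → ℕ) → ∑[ i < n ] f (toℕ i) ≡ sum (applyUpTo f n)
∑-toℕ zero f = refl
∑-toℕ (suc n) f = cong (f 0 +_) (∑-toℕ n (f ∘ suc))

sum-applyUpTo-const : ∀ N {f : ℕ → ℕ} b → (∀ i → f i ≡ b) → sum (applyUpTo f N) ≡ N * b
sum-applyUpTo-const zero b f≗b = refl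
sum-applyUpTo-const (suc N) b f≗b = cong₂ _+_ (f≗b 0) (sum-applyUpTo-const N b (f≗b ∘ suc))

sum-applyUpTo-single : ∀ N j (f : ℕ → ℕ) → j < N → (∀ i → i ≢ j → f i ≡ 0) →
  sum (applyUpTo f N) ≡ f j
sum-applyUpTo-single (suc N) zero f _ others≡0 = begin
  f 0 + sum (applyUpTo (f ∘ suc) N) ≡⟨ cong (f 0 +_) (sum-applyUpTo-const N 0 (λ i → others≡0 (suc i) λ ())) ⟩
  f 0 + N * 0                        ≡⟨ cong (f 0 +_) (*-zeroʳ N) ⟩
  f 0 + 0                            ≡⟨ +-identityʳ (f 0) ⟩
  f 0                                ∎
sum-applyUpTo-single (suc N) (suc j) f (s≤s j<N) others≡0 =
  cong₂ _+_ (others≡0 0 λ ())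
            (sum-applyUpTo-single N j (f ∘ suc) j<N (λ i i≢j → others≡0 (suc i) (i≢j ∘ suc-injective)))

sum-applyUpTo-split : ∀ N a (f g : ℕ → ℕ) b → a ≤ N →
  (∀ i → i < a → f i ≡ g i) → (∀ i → a ≤ i → f i ≡ b) →
  sum (applyUpTo f N) ≡ sum (applyUpTo g a) + (N ∸ a) * b
sum-applyUpTo-split N zero f g b _ _ f≡b = sum-applyUpTo-const N b (λ i → f≡b i z≤n)
sum-applyUpTo-split (suc N) (suc a) f g b (s≤s a≤N) f≡g f≡b =
  trans (cong₂ _+_ (f≡g 0 (s≤s z≤n))
                   (sum-applyUpTo-split N a (f ∘ suc) (g ∘ suc) b a≤N
                      (λ i i<a → f≡g (suc i) (s≤s i<a)) (λ i a≤i → f≡b (suc i) (s≤s a≤i))))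
        (sym (+-assoc (g 0) _ _))

map-reflects : ∀ {A B : Set} {b} → (A → B) → (B → A) → Reflects A b → Reflects B b
map-reflects f g (ofʸ a) = ofʸ (f a)
map-reflects f g (ofⁿ ¬a) = ofⁿ (¬a ∘ g)

≡ᵇ-reflects : ∀ m n → Reflects (m ≡ n) (m ≡ᵇ n)
≡ᵇ-reflects m n = fromEquivalence (≡ᵇ⇒≡ m n) (≡⇒≡ᵇ m n)

≡ᵇ-refl : ∀ n → (n ≡ᵇ n) ≡ true
≡ᵇ-refl n = det (≡ᵇ-reflects n n) (ofʸ refl)

≡ᵇ-≢ : ∀ {m n} → m ≢ n → (m ≡ᵇ n) ≡ false
≡ᵇ-≢ {m} {n} m≢n = det (≡ᵇ-reflects m n) (ofⁿ m≢n)

==ᶠ-reflects : ∀ {n} (x y : Fin n) → Reflects (x ≡ y) (x ==ᶠ y)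
==ᶠ-reflects x y = map-reflects toℕ-injective (cong toℕ) (≡ᵇ-reflects (toℕ x) (toℕ y))

==ᶠ-refl : ∀ {n} (x : Fin n) → (x ==ᶠ x) ≡ true
==ᶠ-refl x = det (==ᶠ-reflects x x) (ofʸ refl)

==ᶠ-≢ : ∀ {n} {x y : Fin n} → x ≢ y → (x ==ᶠ y) ≡ false
==ᶠ-≢ {x = x} {y} x≢y = det (==ᶠ-reflects x y) (ofⁿ x≢y)

==ᶠ-punchIn : ∀ {m} (a : Fin (suc m)) (y z : Fin m) → (punchIn a y ==ᶠ punchIn a z) ≡ (y ==ᶠ z)
==ᶠ-punchIn a y z =
  det (==ᶠ-reflects (punchIn a y) (punchIn a z))
      (map-reflects (cong (punchIn a)) (punchIn-injective a y z) (==ᶠ-reflects y z))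

-- Permutations as injective vectors

all-tabulate-reflects : ∀ {B : Set} {n} {Q : Fin n → Set} (P : B → Bool) (f : Fin n → B) →
  (∀ i → Reflects (Q i) (P (f i))) → Reflects (∀ i → Q i) (all P (tabulate f))
all-tabulate-reflects {n = zero} P f r = ofʸ (λ ())
all-tabulate-reflects {n = suc n} P f r =
  map-reflects (λ { (q₀ , qₛ) zero → q₀ ; (q₀ , qₛ) (suc i) → qₛ i }) (λ q → q zero , q ∘ suc)
    (r zero ×-reflects all-tabulate-reflects P (f ∘ suc) (r ∘ suc))

isPerm-reflects : ∀ {n} (π : Vec (Fin n) n) → Reflects (Injective _≡_ _≡_ (lookup π)) (isPerm π)
isPerm-reflects π =
  map-reflects (λ inj {i} {j} → inj i j) (λ inj i j → inj)
    (all-tabulate-reflects _ id λ i → all-tabulate-reflects _ id λ j →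
      subst (Reflects _) (∨-comm (not (lookup π i ==ᶠ lookup π j)) (i ==ᶠ j))
            (==ᶠ-reflects (lookup π i) (lookup π j) →-reflects ==ᶠ-reflects i j))

fresh : ∀ {n l} → Fin n → Vec (Fin n) l → Bool
fresh a [] = true
fresh a (x ∷ v) = not (a ==ᶠ x) ∧ fresh a v

distinct : ∀ {n l} → Vec (Fin n) l → Bool
distinct [] = true
distinct (x ∷ v) = fresh x v ∧ distinct v

fresh-reflects : ∀ {n l} (a : Fin n) (v : Vec (Fin n) l) → Reflects (∀ j → a ≢ lookup v j) (fresh a v)
fresh-reflects a [] = ofʸ (λ ())
fresh-reflects a (x ∷ v) =
  map-reflects (λ { (a≢x , a∉v) zero → a≢x ; (a≢x , a∉v) (suc j) → a∉v j }) (λ a∉ → a∉ zero , a∉ ∘ suc)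
    (¬-reflects (==ᶠ-reflects a x) ×-reflects fresh-reflects a v)

distinct-reflects : ∀ {n l} (v : Vec (Fin n) l) → Reflects (Injective _≡_ _≡_ (lookup v)) (distinct v)
distinct-reflects [] = ofʸ λ { {()} }
distinct-reflects (x ∷ v) =
  map-reflects cons-injective (λ inj → (λ j → 0≢1+n ∘ inj) , fsuc-injective ∘ inj)
    (fresh-reflects x v ×-reflects distinct-reflects v)
  where
  cons-injective : (∀ j → x ≢ lookup v j) × Injective _≡_ _≡_ (lookup v) →
    Injective _≡_ _≡_ (lookup (x ∷ v))
  cons-injective _ {zero} {zero} _ = refl
  cons-injective (x∉v , _) {zero} {suc j} e = ⊥-elim (x∉v j e)
  cons-injective (x∉v , _) {suc i} {zero} e = ⊥-elim (x∉v i (sym e))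
  cons-injective (_ , inj) {suc i} {suc j} e = cong suc (inj e)

isPerm≡distinct : ∀ {n} (π : Vec (Fin n) n) → isPerm π ≡ distinct π
isPerm≡distinct π = det (isPerm-reflects π) (distinct-reflects π)

fresh-punchIn : ∀ {m l} (a : Fin (suc m)) (y : Fin m) (v : Vec (Fin m) l) →
  fresh (punchIn a y) (Vec.map (punchIn a) v) ≡ fresh y v
fresh-punchIn a y [] = refl
fresh-punchIn a y (x ∷ v) rewrite ==ᶠ-punchIn a y x | fresh-punchIn a y v = refl

distinct-punchIn : ∀ {m l} (a : Fin (suc m)) (v : Vec (Fin m) l) →
  distinct (Vec.map (punchIn a) v) ≡ distinct v
distinct-punchIn a [] = refl
distinct-punchIn a (x ∷ v) rewrite fresh-punchIn a x v | distinct-punchIn a v = refl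

-- Vectors over Fin (suc m) avoiding a are exactly the punchIn a images of vectors over Fin m.
count-fresh : ∀ {m} l (a : Fin (suc m)) (Q : Vec (Fin (suc m)) l → Bool) →
  count (λ v → fresh a v ∧ Q v) (allVecs (suc m) l) ≡ count (Q ∘ Vec.map (punchIn a)) (allVecs m l)
count-fresh zero a Q = refl
count-fresh {m} (suc l) a Q = begin
  count (λ v → fresh a v ∧ Q v) (allVecs (suc m) (suc l))
    ≡⟨ count-allVecs-suc (suc m) l _ ⟩
  ∑[ x < suc m ] count (λ v → (not (a ==ᶠ x) ∧ fresh a v) ∧ Q (x ∷ v)) (allVecs (suc m) l)
    ≡⟨ sum-remove {i = a} (λ x → count (λ v → (not (a ==ᶠ x) ∧ fresh a v) ∧ Q (x ∷ v)) (allVecs (suc m) l)) ⟩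
  count (λ v → (not (a ==ᶠ a) ∧ fresh a v) ∧ Q (a ∷ v)) (allVecs (suc m) l)
    + ∑[ y < m ] count (λ v → (not (a ==ᶠ punchIn a y) ∧ fresh a v) ∧ Q (punchIn a y ∷ v)) (allVecs (suc m) l)
    ≡⟨ cong₂ _+_ (count-all-false (λ v → cong (λ b → (not b ∧ fresh a v) ∧ Q (a ∷ v)) (==ᶠ-refl a))
                                  (allVecs (suc m) l))
                 (sum-cong-≗ fresh-tail) ⟩
  ∑[ y < m ] count (λ ρ → Q (punchIn a y ∷ Vec.map (punchIn a) ρ)) (allVecs m l)
    ≡⟨ count-allVecs-suc m l _ ⟨
  count (Q ∘ Vec.map (punchIn a)) (allVecs m (suc l))
    ∎
  where
  fresh-tail : ∀ y → count (λ v → (not (a ==ᶠ punchIn a y) ∧ fresh a v) ∧ Q (punchIn a y ∷ v)) (allVecs (suc m) l)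
                   ≡ count (λ ρ → Q (punchIn a y ∷ Vec.map (punchIn a) ρ)) (allVecs m l)
  fresh-tail y rewrite ==ᶠ-≢ (punchInᵢ≢i a y ∘ sym) = count-fresh l a (λ v → Q (punchIn a y ∷ v))

values : ∀ {n l} → Vec (Fin n) l → List ℕ
values [] = []
values (x ∷ v) = toℕ x ∷ values v

punchInℕ : ℕ → ℕ → ℕ
punchInℕ zero y = suc y
punchInℕ (suc c) zero = zero
punchInℕ (suc c) (suc y) = suc (punchInℕ c y)

toℕ-punchIn : ∀ {m} (a : Fin (suc m)) (x : Fin m) → toℕ (punchIn a x) ≡ punchInℕ (toℕ a) (toℕ x)
toℕ-punchIn zero x = refl
toℕ-punchIn (suc a) zero = refl
toℕ-punchIn (suc a) (suc x) = cong suc (toℕ-punchIn a x)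

values-punchIn : ∀ {m l} (a : Fin (suc m)) (v : Vec (Fin m) l) →
  values (Vec.map (punchIn a) v) ≡ map (punchInℕ (toℕ a)) (values v)
values-punchIn a [] = refl
values-punchIn a (x ∷ v) = cong₂ _∷_ (toℕ-punchIn a x) (values-punchIn a v)

countPerms : ℕ → (List ℕ → Bool) → ℕ
countPerms n H = count (λ σ → distinct σ ∧ H (values σ)) (allVecs n n)

countPerms-cong : ∀ n {H H′ : List ℕ → Bool} → (∀ ys → H ys ≡ H′ ys) → countPerms n H ≡ countPerms n H′
countPerms-cong n H≗H′ = count-cong (λ σ → cong (distinct σ ∧_) (H≗H′ (values σ))) (allVecs n n)

countPerms-false : ∀ n {H : List ℕ → Bool} → (∀ ys → H ys ≡ false) → countPerms n H ≡ 0
countPerms-false n H≗false =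
  count-all-false (λ σ → trans (cong (distinct σ ∧_) (H≗false (values σ))) (∧-zeroʳ _)) (allVecs n n)

perms≡filterᵇ : ∀ n → perms n ≡ filterᵇ isPerm (allVecs n n)
perms≡filterᵇ n with filterᵇ-unique isPerm _ refl (λ _ _ → refl) | allVecs n n
... | unique | vecs = unique vecs

count-perms : ∀ n (P : Vec (Fin n) n → Bool) → count P (perms n) ≡ count (λ π → distinct π ∧ P π) (allVecs n n)
count-perms n P = begin
  count P (perms n)
    ≡⟨ cong (count P) (perms≡filterᵇ n) ⟩
  count P (filterᵇ isPerm (allVecs n n))
    ≡⟨ count-filterᵇ isPerm P (allVecs n n) ⟩
  count (λ π → isPerm π ∧ P π) (allVecs n n)
    ≡⟨ count-cong (λ π → cong (_∧ P π) (isPerm≡distinct π)) (allVecs n n) ⟩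
  count (λ π → distinct π ∧ P π) (allVecs n n)
    ∎

-- σ ∈ S_{m+1} corresponds to its first value c and the standardisation of σ₂⋯σ_{m+1}.
countPerms-suc : ∀ m (H : List ℕ → Bool) →
  countPerms (suc m) H ≡ sum (applyUpTo (λ c → countPerms m (λ ys → H (c ∷ map (punchInℕ c) ys))) (suc m))
countPerms-suc m H = begin
  countPerms (suc m) H
    ≡⟨ count-allVecs-suc (suc m) m _ ⟩
  ∑[ a < suc m ] count (λ v → (fresh a v ∧ distinct v) ∧ H (toℕ a ∷ values v)) (allVecs (suc m) m)
    ≡⟨ sum-cong-≗ (λ a →
         trans (count-cong (λ v → ∧-assoc (fresh a v) (distinct v) (H (toℕ a ∷ values v))) (allVecs (suc m) m))
               (count-fresh m a (λ v → distinct v ∧ H (toℕ a ∷ values v)))) ⟩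
  ∑[ a < suc m ] count (λ ρ → distinct (Vec.map (punchIn a) ρ) ∧ H (toℕ a ∷ values (Vec.map (punchIn a) ρ)))
                       (allVecs m m)
    ≡⟨ sum-cong-≗ (λ a → count-cong (λ ρ → cong₂ (λ b ys → b ∧ H (toℕ a ∷ ys))
                                                   (distinct-punchIn a ρ) (values-punchIn a ρ)) (allVecs m m)) ⟩
  ∑[ a < suc m ] countPerms m (λ ys → H (toℕ a ∷ map (punchInℕ (toℕ a)) ys))
    ≡⟨ ∑-toℕ (suc m) (λ c → countPerms m (λ ys → H (c ∷ map (punchInℕ c) ys))) ⟩
  sum (applyUpTo (λ c → countPerms m (λ ys → H (c ∷ map (punchInℕ c) ys))) (suc m))
    ∎

startsWith : ℕ → List ℕ → Bool
startsWith s [] = false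
startsWith s (x ∷ _) = suc x ≡ᵇ s

countPerms-startsWith : ∀ m a (H : List ℕ → Bool) → a ≤ m →
  countPerms (suc m) (λ xs → H xs ∧ startsWith (suc a) xs) ≡ countPerms m (λ ys → H (a ∷ map (punchInℕ a) ys))
countPerms-startsWith m a H a≤m = begin
  countPerms (suc m) (λ xs → H xs ∧ startsWith (suc a) xs)
    ≡⟨ countPerms-suc m (λ xs → H xs ∧ startsWith (suc a) xs) ⟩
  sum (applyUpTo starting (suc m))
    ≡⟨ sum-applyUpTo-single (suc m) a starting (s≤s a≤m) other-start ⟩
  starting a
    ≡⟨ countPerms-cong m (λ ys → trans (cong (H (a ∷ map (punchInℕ a) ys) ∧_) (≡ᵇ-refl a)) (∧-identityʳ _)) ⟩
  countPerms m (λ ys → H (a ∷ map (punchInℕ a) ys))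
    ∎
  where
  starting : ℕ → ℕ
  starting c = countPerms m (λ ys → H (c ∷ map (punchInℕ c) ys) ∧ (c ≡ᵇ a))
  other-start : ∀ c → c ≢ a → starting c ≡ 0
  other-start c c≢a =
    countPerms-false m (λ ys → trans (cong (H (c ∷ map (punchInℕ c) ys) ∧_) (≡ᵇ-≢ c≢a)) (∧-zeroʳ _))

-- Left-to-right minima

lrMinima : (ℕ → Bool) → List ℕ → List Bool
lrMinima B [] = []
lrMinima B (x ∷ xs) = B x ∷ lrMinima (λ y → B y ∧ (y <ᵇ x)) xs

-- The left-to-right minima of a tail that follows a prefix with minimum a.
lrMinimaBelow : ℕ → List ℕ → List Bool
lrMinimaBelow a = lrMinima (_<ᵇ a)

lrMinima-cong : ∀ {B B′ : ℕ → Bool} → (∀ y → B y ≡ B′ y) → ∀ xs → lrMinima B xs ≡ lrMinima B′ xs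
lrMinima-cong B≗B′ [] = refl
lrMinima-cong B≗B′ (x ∷ xs) = cong₂ _∷_ (B≗B′ x) (lrMinima-cong (λ y → cong (_∧ (y <ᵇ x)) (B≗B′ y)) xs)

lrMinima-map : (f : ℕ → ℕ) → (∀ x y → (f x <ᵇ f y) ≡ (x <ᵇ y)) →
  ∀ {B B′ : ℕ → Bool} → (∀ y → B′ (f y) ≡ B y) → ∀ xs → lrMinima B′ (map f xs) ≡ lrMinima B xs
lrMinima-map f f-<ᵇ B′∘f≗B [] = refl
lrMinima-map f f-<ᵇ B′∘f≗B (x ∷ xs) =
  cong₂ _∷_ (B′∘f≗B x) (lrMinima-map f f-<ᵇ (λ y → cong₂ _∧_ (B′∘f≗B y) (f-<ᵇ y x)) xs)

punchInℕ-<ᵇ : ∀ c x y → (punchInℕ c x <ᵇ punchInℕ c y) ≡ (x <ᵇ y)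
punchInℕ-<ᵇ zero x y = refl
punchInℕ-<ᵇ (suc c) zero zero = refl
punchInℕ-<ᵇ (suc c) zero (suc y) = refl
punchInℕ-<ᵇ (suc c) (suc x) zero = refl
punchInℕ-<ᵇ (suc c) (suc x) (suc y) = punchInℕ-<ᵇ c x y

punchInℕ-<ᵇ-below : ∀ {a c} → a ≤ c → ∀ y → (punchInℕ c y <ᵇ a) ≡ (y <ᵇ a)
punchInℕ-<ᵇ-below z≤n y = refl
punchInℕ-<ᵇ-below (s≤s a≤c) zero = refl
punchInℕ-<ᵇ-below (s≤s a≤c) (suc y) = punchInℕ-<ᵇ-below a≤c y

lrMinimaBelow-punchIn : ∀ {a c} → a ≤ c → ∀ xs → lrMinimaBelow a (map (punchInℕ c) xs) ≡ lrMinimaBelow a xs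
lrMinimaBelow-punchIn {c = c} a≤c = lrMinima-map (punchInℕ c) (punchInℕ-<ᵇ c) (punchInℕ-<ᵇ-below a≤c)

lrMinimaBelow-∷-< : ∀ {a c} → c < a → ∀ zs → lrMinimaBelow a (c ∷ zs) ≡ true ∷ lrMinimaBelow c zs
lrMinimaBelow-∷-< {a} {c} c<a = cong₂ _∷_ (det (<ᵇ-reflects-< c a) (ofʸ c<a)) ∘ lrMinima-cong below-both
  where
  below-both : ∀ y → (y <ᵇ a) ∧ (y <ᵇ c) ≡ (y <ᵇ c)
  below-both y = det (<ᵇ-reflects-< y a ×-reflects <ᵇ-reflects-< y c)
                     (map-reflects (λ y<c → <-trans y<c c<a , y<c) proj₂ (<ᵇ-reflects-< y c))

lrMinimaBelow-∷-≥ : ∀ {a c} → a ≤ c → ∀ zs → lrMinimaBelow a (c ∷ zs) ≡ false ∷ lrMinimaBelow a zs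
lrMinimaBelow-∷-≥ {a} {c} a≤c = cong₂ _∷_ (det (<ᵇ-reflects-< c a) (ofⁿ (≤⇒≯ a≤c))) ∘ lrMinima-cong below-both
  where
  below-both : ∀ y → (y <ᵇ a) ∧ (y <ᵇ c) ≡ (y <ᵇ a)
  below-both y = det (<ᵇ-reflects-< y a ×-reflects <ᵇ-reflects-< y c)
                     (map-reflects (λ y<a → y<a , <-≤-trans y<a a≤c) proj₁ (<ᵇ-reflects-< y a))

all-const-true : ∀ {A : Set} (xs : List A) → all (λ _ → true) xs ≡ true
all-const-true [] = refl
all-const-true (x ∷ xs) = all-const-true xs

all-tabulate-cong : ∀ {A B : Set} {n} (f : Fin n → A) (g : Fin n → B) {P : A → Bool} {Q : B → Bool} →
  (∀ i → P (f i) ≡ Q (g i)) → all P (tabulate f) ≡ all Q (tabulate g)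
all-tabulate-cong {n = zero} f g P∘f≗Q∘g = refl
all-tabulate-cong {n = suc n} f g P∘f≗Q∘g =
  cong₂ _∧_ (P∘f≗Q∘g zero) (all-tabulate-cong (f ∘ suc) (g ∘ suc) (P∘f≗Q∘g ∘ suc))

-- isLRMin for vectors whose length differs from the alphabet size, such as tails of permutations.
isLRMin′ : ∀ {m l} → Vec (Fin m) l → Fin l → Bool
isLRMin′ {l = l} π i = all (λ j → not (toℕ j <ᵇ toℕ i) ∨ (toℕ (lookup π i) <ᵇ toℕ (lookup π j))) (allFin l)

isLRMin′-suc : ∀ {m l} (x : Fin m) (v : Vec (Fin m) l) (i : Fin l) →
  isLRMin′ (x ∷ v) (suc i) ≡ (toℕ (lookup v i) <ᵇ toℕ x) ∧ isLRMin′ v i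
isLRMin′-suc {l = l} x v i = cong ((toℕ (lookup v i) <ᵇ toℕ x) ∧_)
  (all-tabulate-cong {n = l} suc id
     {P = λ j → not (toℕ j <ᵇ toℕ (Fin.suc i)) ∨ (toℕ (lookup v i) <ᵇ toℕ (lookup (x ∷ v) j))}
     {Q = λ j → not (toℕ j <ᵇ toℕ i) ∨ (toℕ (lookup v i) <ᵇ toℕ (lookup v j))} (λ j → refl))

tabulate-isLRMin′ : ∀ {m l} (v : Vec (Fin m) l) (B : ℕ → Bool) →
  tabulate (λ i → B (toℕ (lookup v i)) ∧ isLRMin′ v i) ≡ lrMinima B (values v)
tabulate-isLRMin′ [] B = refl
tabulate-isLRMin′ {l = suc l} (x ∷ v) B = cong₂ _∷_
  (trans (cong (B (toℕ x) ∧_) (all-const-true (allFin (suc l)))) (∧-identityʳ _))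
  (trans (tabulate-cong (λ i → trans (cong (B (toℕ (lookup v i)) ∧_) (isLRMin′-suc x v i))
                                     (sym (∧-assoc (B (toℕ (lookup v i))) _ _))))
         (tabulate-isLRMin′ v (λ y → B y ∧ (y <ᵇ toℕ x))))

isLRMin≡lrMinima : ∀ {n} (π : Vec (Fin n) n) → map (isLRMin π) (allFin n) ≡ lrMinima (λ _ → true) (values π)
isLRMin≡lrMinima π = trans (map-tabulate id (isLRMin π)) (tabulate-isLRMin′ π (λ _ → true))

-- The elimination game

wins : ℕ → List ℕ → List Bool → Bool
wins k q [] = onlyPlayer k q
wins k q (b ∷ bs) = (2 ≤ᵇ length q) ∧ wins k (throw q b) bs

all-applyUpTo-cong : ∀ N (f g : ℕ → ℕ) {P Q : ℕ → Bool} →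
  (∀ i → P (f i) ≡ Q (g i)) → all P (applyUpTo f N) ≡ all Q (applyUpTo g N)
all-applyUpTo-cong zero f g P∘f≗Q∘g = refl
all-applyUpTo-cong (suc N) f g P∘f≗Q∘g =
  cong₂ _∧_ (P∘f≗Q∘g 0) (all-applyUpTo-cong N (f ∘ suc) (g ∘ suc) (P∘f≗Q∘g ∘ suc))

wins-play : ∀ k q bs →
  all (λ m → 2 ≤ᵇ length (play q (take m bs))) (upTo (length bs)) ∧ onlyPlayer k (play q (take (length bs) bs))
  ≡ wins k q bs
wins-play k q [] = refl
wins-play k q (b ∷ bs) =
  trans (∧-assoc (2 ≤ᵇ length q) _ _)
        (cong ((2 ≤ᵇ length q) ∧_)
              (trans (cong (_∧ onlyPlayer k (play (throw q b) (take (length bs) bs)))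
                           (all-applyUpTo-cong (length bs) suc id (λ i → refl)))
                     (wins-play k (throw q b) bs)))

players : ℕ → List ℕ
players p = applyUpTo suc p

wonBy≡wins : ∀ {n} p k (π : Vec (Fin n) n) → wonBy p k π ≡ wins k (players p) (lrMinima (λ _ → true) (values π))
wonBy≡wins {n} p k π = begin
  wonBy p k π
    ≡⟨ cong (λ N → all (λ m → 2 ≤ᵇ length (play (players p) (take m throws))) (upTo N)
                   ∧ onlyPlayer k (play (players p) (take N throws))) (sym length-throws) ⟩
  all (λ m → 2 ≤ᵇ length (play (players p) (take m throws))) (upTo (length throws))
    ∧ onlyPlayer k (play (players p) (take (length throws) throws))
    ≡⟨ wins-play k (players p) throws ⟩
  wins k (players p) throws
    ≡⟨ cong (wins k (players p)) (isLRMin≡lrMinima π) ⟩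
  wins k (players p) (lrMinima (λ _ → true) (values π))
    ∎
  where
  throws = map (isLRMin π) (allFin n)
  length-throws : length throws ≡ n
  length-throws = trans (length-map (isLRMin π) (allFin n)) (length-tabulate id)

throw-map : ∀ (f : ℕ → ℕ) q b → throw (map f q) b ≡ map f (throw q b)
throw-map f [] b = refl
throw-map f (x ∷ q) true = sym (map-++ f q (x ∷ []))
throw-map f (x ∷ q) false = refl

wins-map : ∀ (f : ℕ → ℕ) {k k′} → (∀ x → (f x ≡ᵇ k) ≡ (x ≡ᵇ k′)) →
  ∀ q bs → wins k (map f q) bs ≡ wins k′ q bs
wins-map f f-≡ᵇ [] [] = refl
wins-map f f-≡ᵇ (x ∷ []) [] = f-≡ᵇ x
wins-map f f-≡ᵇ (x ∷ y ∷ q) [] = refl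
wins-map f f-≡ᵇ q (b ∷ bs) =
  cong₂ _∧_ (cong (2 ≤ᵇ_) (length-map f q))
            (trans (cong (λ q′ → wins _ q′ bs) (throw-map f q b)) (wins-map f f-≡ᵇ (throw q b) bs))

wins-map-absent : ∀ (f : ℕ → ℕ) {k} → (∀ x → (f x ≡ᵇ k) ≡ false) → ∀ q bs → wins k (map f q) bs ≡ false
wins-map-absent f f-≢ [] [] = refl
wins-map-absent f f-≢ (x ∷ []) [] = f-≢ x
wins-map-absent f f-≢ (x ∷ y ∷ q) [] = refl
wins-map-absent f f-≢ q (b ∷ bs) =
  trans (cong (_ ∧_) (trans (cong (λ q′ → wins _ q′ bs) (throw-map f q b)) (wins-map-absent f f-≢ (throw q b) bs)))
        (∧-zeroʳ _)

map-applyUpTo : ∀ {A B : Set} (f : A → B) (g : ℕ → A) n → map f (applyUpTo g n) ≡ applyUpTo (f ∘ g) n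
map-applyUpTo f g zero = refl
map-applyUpTo f g (suc n) = cong (f (g 0) ∷_) (map-applyUpTo f (g ∘ suc) n)

applyUpTo-cong-< : ∀ {A : Set} n {f g : ℕ → A} → (∀ i → i < n → f i ≡ g i) → applyUpTo f n ≡ applyUpTo g n
applyUpTo-cong-< zero f≗g = refl
applyUpTo-cong-< (suc n) f≗g = cong₂ _∷_ (f≗g 0 (s≤s z≤n)) (applyUpTo-cong-< n (λ i i<n → f≗g (suc i) (s≤s i<n)))

-- Player at position x of the line 2,…,p,1.  Position 0 is not used; fixing it keeps the
-- hypothesis of wins-map true for every x.
rotate : ℕ → ℕ → ℕ
rotate p zero = zero
rotate p (suc y) = if suc y ≡ᵇ p then 1 else suc (suc y)

rotate-≡ᵇ : ∀ {p k} → 1 ≤ k → k ≤ p → ∀ x → (rotate p x ≡ᵇ k) ≡ (x ≡ᵇ kbar p k)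
rotate-≡ᵇ {suc p} {1} _ _ zero = refl
rotate-≡ᵇ {p} {1} _ _ (suc y) with suc y ≡ᵇ p
... | true = refl
... | false = refl
rotate-≡ᵇ {p} {suc (suc j)} _ _ zero = refl
rotate-≡ᵇ {p} {suc (suc j)} _ k≤p (suc y) with suc y ≡ᵇ p in eq
... | false = refl
... | true with ≡ᵇ⇒≡ (suc y) p (subst T (sym eq) _)
...   | refl with k≤p
...     | s≤s j<y = sym (≡ᵇ-≢ (>⇒≢ j<y))

rotate-players : ∀ p → map (rotate (suc p)) (players (suc p)) ≡ applyUpTo (2 +_) p ∷ʳ 1
rotate-players p = begin
  map (rotate (suc p)) (applyUpTo suc (suc p))
    ≡⟨ map-applyUpTo (rotate (suc p)) suc (suc p) ⟩
  applyUpTo (rotate (suc p) ∘ suc) (suc p)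
    ≡⟨ applyUpTo-∷ʳ (rotate (suc p) ∘ suc) p ⟨
  applyUpTo (rotate (suc p) ∘ suc) p ∷ʳ rotate (suc p) (suc p)
    ≡⟨ cong₂ _∷ʳ_ (applyUpTo-cong-< p (λ i i<p → cong (λ b → if b then 1 else suc (suc i)) (≡ᵇ-≢ (<⇒≢ i<p))))
                  (cong (λ b → if b then 1 else suc (suc p)) (≡ᵇ-refl p)) ⟩
  applyUpTo (2 +_) p ∷ʳ 1
    ∎

wins-first-survives : ∀ q {k} → 1 ≤ k → k ≤ 2 + q → ∀ bs →
  wins k (players (2 + q)) (true ∷ bs) ≡ wins (kbar (2 + q) k) (players (2 + q)) bs
wins-first-survives q {k} 1≤k k≤p bs = begin
  wins k (players (2 + q)) (true ∷ bs)
    ≡⟨ cong (λ line → wins k line bs) (rotate-players (suc q)) ⟨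
  wins k (map (rotate (2 + q)) (players (2 + q))) bs
    ≡⟨ wins-map (rotate (2 + q)) (rotate-≡ᵇ 1≤k k≤p) (players (2 + q)) bs ⟩
  wins (kbar (2 + q) k) (players (2 + q)) bs
    ∎

-- Player at position x of the line 1,3,…,p (0 fixed as for rotate).
skip : ℕ → ℕ
skip zero = zero
skip (suc zero) = 1
skip (suc (suc y)) = suc (suc (suc y))

length-∷ʳ : ∀ {A : Set} (xs : List A) x → length (xs ∷ʳ x) ≡ suc (length xs)
length-∷ʳ xs x = trans (length-++ xs) (+-comm (length xs) 1)

wins-after-second-throw : ∀ q k bs →
  wins k (players (2 + q)) (true ∷ false ∷ bs) ≡ wins k (map skip (throw (players (suc q)) true)) bs
wins-after-second-throw q k bs = begin
  wins k (players (2 + q)) (true ∷ false ∷ bs)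
    ≡⟨ cong (λ ℓ → (0 <ᵇ ℓ) ∧ wins k (later ∷ʳ 1) bs) (length-∷ʳ later 1) ⟩
  wins k (later ∷ʳ 1) bs
    ≡⟨ cong (λ line → wins k line bs) skip-line ⟨
  wins k (map skip (throw (players (suc q)) true)) bs
    ∎
  where
  later = applyUpTo (3 +_) q
  skip-line : map skip (applyUpTo (2 +_) q ∷ʳ 1) ≡ later ∷ʳ 1
  skip-line = trans (map-++ skip (applyUpTo (2 +_) q) (1 ∷ [])) (cong (_∷ʳ 1) (map-applyUpTo skip (2 +_) q))

wins-second-eliminated : ∀ q {k k′} → (∀ x → (skip x ≡ᵇ k) ≡ (x ≡ᵇ k′)) → ∀ b bs →
  wins k (players (2 + q)) (true ∷ false ∷ b ∷ bs) ≡ wins k′ (players (suc q)) (true ∷ b ∷ bs)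
wins-second-eliminated q {k} {k′} skip-≡ᵇ b bs = begin
  wins k (players (2 + q)) (true ∷ false ∷ b ∷ bs)
    ≡⟨ wins-after-second-throw q k (b ∷ bs) ⟩
  wins k (map skip line) (b ∷ bs)
    ≡⟨ wins-map skip skip-≡ᵇ line (b ∷ bs) ⟩
  wins k′ line (b ∷ bs)
    ≡⟨ cong (λ c → c ∧ wins k′ (throw line b) bs) (∧-idem (2 ≤ᵇ length line)) ⟨
  ((2 ≤ᵇ length line) ∧ (2 ≤ᵇ length line)) ∧ wins k′ (throw line b) bs
    ≡⟨ ∧-assoc (2 ≤ᵇ length line) _ _ ⟩
  (2 ≤ᵇ length line) ∧ wins k′ line (b ∷ bs)
    ≡⟨ cong (λ ℓ → (2 ≤ᵇ ℓ) ∧ wins k′ line (b ∷ bs)) (length-∷ʳ (applyUpTo (2 +_) q) 1) ⟩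
  wins k′ (players (suc q)) (true ∷ b ∷ bs)
    ∎
  where
  line = throw (players (suc q)) true

wins-2-second-eliminated : ∀ q bs → wins 2 (players (2 + q)) (true ∷ false ∷ bs) ≡ false
wins-2-second-eliminated q bs =
  trans (wins-after-second-throw q 2 bs) (wins-map-absent skip skip-≢2 (throw (players (suc q)) true) bs)
  where
  skip-≢2 : ∀ x → (skip x ≡ᵇ 2) ≡ false
  skip-≢2 zero = refl
  skip-≢2 (suc zero) = refl
  skip-≢2 (suc (suc x)) = refl

-- The recurrence

firstIs≡startsWith : ∀ {n} s (π : Vec (Fin n) n) → firstIs s π ≡ startsWith s (values π)
firstIs≡startsWith s [] = refl
firstIs≡startsWith s (x ∷ π) = refl

w≡countPerms : ∀ n p k s →
  w n p k s ≡ countPerms n (λ xs → wins k (players p) (lrMinima (λ _ → true) xs) ∧ startsWith s xs)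
w≡countPerms n p k s =
  trans (count-perms n (λ π → wonBy p k π ∧ firstIs s π))
        (count-cong (λ π → cong (distinct π ∧_) (cong₂ _∧_ (wonBy≡wins p k π) (firstIs≡startsWith s π)))
                    (allVecs n n))

w-first-value : ∀ m p k a → a ≤ m →
  w (suc m) p k (suc a) ≡ countPerms m (λ ys → wins k (players p) (true ∷ lrMinimaBelow a ys))
w-first-value m p k a a≤m = begin
  w (suc m) p k (suc a)
    ≡⟨ w≡countPerms (suc m) p k (suc a) ⟩
  countPerms (suc m) (λ xs → wins k (players p) (lrMinima (λ _ → true) xs) ∧ startsWith (suc a) xs)
    ≡⟨ countPerms-startsWith m a (λ xs → wins k (players p) (lrMinima (λ _ → true) xs)) a≤m ⟩
  countPerms m (λ ys → wins k (players p) (true ∷ lrMinimaBelow a (map (punchInℕ a) ys)))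
    ≡⟨ countPerms-cong m (λ ys → cong (λ t → wins k (players p) (true ∷ t)) (lrMinimaBelow-punchIn {a} ≤-refl ys)) ⟩
  countPerms m (λ ys → wins k (players p) (true ∷ lrMinimaBelow a ys))
    ∎

countSecondEliminated : ℕ → ℕ → ℕ → ℕ → ℕ
countSecondEliminated m q k a = countPerms m (λ zs → wins k (players (2 + q)) (true ∷ false ∷ lrMinimaBelow a zs))

countSecondEliminated≡w : ∀ m q {k k′} a → (∀ x → (skip x ≡ᵇ k) ≡ (x ≡ᵇ k′)) → a ≤ suc m →
  countSecondEliminated (suc m) q k a ≡ w (2 + m) (suc q) k′ (suc a)
countSecondEliminated≡w m q {k} {k′} a skip-≡ᵇ a≤ =
  trans (count-cong drop-second (allVecs (suc m) (suc m))) (sym (w-first-value (suc m) (suc q) k′ a a≤))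
  where
  drop-second : (σ : Vec (Fin (suc m)) (suc m)) →
    distinct σ ∧ wins k (players (2 + q)) (true ∷ false ∷ lrMinimaBelow a (values σ))
    ≡ distinct σ ∧ wins k′ (players (suc q)) (true ∷ lrMinimaBelow a (values σ))
  drop-second (x ∷ ρ) = cong (distinct (x ∷ ρ) ∧_)
    (wins-second-eliminated q skip-≡ᵇ (toℕ x <ᵇ a) (lrMinima (λ y → (y <ᵇ a) ∧ (y <ᵇ toℕ x)) (values ρ)))

secondTerm-diagonal : ∀ n p k → secondTerm n p k n ≡ 0
secondTerm-diagonal n p zero = refl
secondTerm-diagonal n p (suc zero) = cong (_* w (n ∸ 1) (p ∸ 1) 1 n) (n∸n≡0 n)
secondTerm-diagonal n p (suc (suc zero)) = refl
secondTerm-diagonal n p (suc (suc (suc j))) = cong (_* w (n ∸ 1) (p ∸ 1) (suc (suc j)) n) (n∸n≡0 n)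

secondTerm≡countSecondEliminated : ∀ m q k a → 1 ≤ k → a ≤ 2 + m →
  (2 + m ∸ a) * countSecondEliminated (suc m) q k a ≡ secondTerm (3 + m) (2 + q) k (suc a)
secondTerm≡countSecondEliminated m q k a 1≤k a≤ with m≤n⇒m<n∨m≡n a≤
... | inj₂ refl rewrite n∸n≡0 m = sym (secondTerm-diagonal (3 + m) (2 + q) k)
... | inj₁ (s≤s a≤1+m) = by-winner k 1≤k
  where
  by-winner : ∀ k → 1 ≤ k → (2 + m ∸ a) * countSecondEliminated (suc m) q k a ≡ secondTerm (3 + m) (2 + q) k (suc a)
  by-winner (suc zero) _ = cong ((2 + m ∸ a) *_) (countSecondEliminated≡w m q a skip-≡ᵇ1 a≤1+m)
    where
    skip-≡ᵇ1 : ∀ x → (skip x ≡ᵇ 1) ≡ (x ≡ᵇ 1)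
    skip-≡ᵇ1 zero = refl
    skip-≡ᵇ1 (suc zero) = refl
    skip-≡ᵇ1 (suc (suc x)) = refl
  by-winner (suc (suc zero)) _ =
    trans (cong ((2 + m ∸ a) *_) (countPerms-false (suc m) (λ ys → wins-2-second-eliminated q (lrMinimaBelow a ys))))
          (*-zeroʳ (2 + m ∸ a))
  by-winner (suc (suc (suc j))) _ = cong ((2 + m ∸ a) *_) (countSecondEliminated≡w m q a skip-≡ᵇ a≤1+m)
    where
    skip-≡ᵇ : ∀ x → (skip x ≡ᵇ 3 + j) ≡ (x ≡ᵇ 2 + j)
    skip-≡ᵇ zero = refl
    skip-≡ᵇ (suc zero) = refl
    skip-≡ᵇ (suc (suc x)) = refl

w-recurrence : ∀ m q k a → 1 ≤ k → k ≤ 2 + q → a ≤ 2 + m →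
  w (3 + m) (2 + q) k (suc a)
  ≡ sumTo (suc a) (λ s′ → w (2 + m) (2 + q) (kbar (2 + q) k) s′) + secondTerm (3 + m) (2 + q) k (suc a)
w-recurrence m q k a 1≤k k≤p a≤ = begin
  w (3 + m) p k (suc a)
    ≡⟨ w-first-value (2 + m) p k a a≤ ⟩
  countPerms (2 + m) Ψ
    ≡⟨ countPerms-suc (suc m) Ψ ⟩
  sum (applyUpTo (λ c → countPerms (suc m) (λ zs → Ψ (c ∷ map (punchInℕ c) zs))) (2 + m))
    ≡⟨ sum-applyUpTo-split (2 + m) a _ (λ c → w (2 + m) p (kbar p k) (suc c)) _ a≤ smaller larger ⟩
  sumTo (suc a) (λ s′ → w (2 + m) p (kbar p k) s′) + (2 + m ∸ a) * countSecondEliminated (suc m) q k a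
    ≡⟨ cong (sumTo (suc a) (λ s′ → w (2 + m) p (kbar p k) s′) +_)
            (secondTerm≡countSecondEliminated m q k a 1≤k a≤) ⟩
  sumTo (suc a) (λ s′ → w (2 + m) p (kbar p k) s′) + secondTerm (3 + m) p k (suc a)
    ∎
  where
  p = 2 + q
  Ψ : List ℕ → Bool
  Ψ ys = wins k (players p) (true ∷ lrMinimaBelow a ys)
  smaller : ∀ c → c < a → countPerms (suc m) (λ zs → Ψ (c ∷ map (punchInℕ c) zs)) ≡ w (2 + m) p (kbar p k) (suc c)
  smaller c c<a = trans (countPerms-cong (suc m) second-survives) (sym (w-first-value (suc m) p (kbar p k) c c≤1+m))
    where
    c≤1+m = ≤-pred (<-≤-trans c<a a≤)
    second-survives : ∀ zs → Ψ (c ∷ map (punchInℕ c) zs) ≡ wins (kbar p k) (players p) (true ∷ lrMinimaBelow c zs)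
    second-survives zs = begin
      wins k (players p) (true ∷ lrMinimaBelow a (c ∷ map (punchInℕ c) zs))
        ≡⟨ cong (λ t → wins k (players p) (true ∷ t)) (lrMinimaBelow-∷-< c<a (map (punchInℕ c) zs)) ⟩
      wins k (players p) (true ∷ true ∷ lrMinimaBelow c (map (punchInℕ c) zs))
        ≡⟨ wins-first-survives q 1≤k k≤p (true ∷ lrMinimaBelow c (map (punchInℕ c) zs)) ⟩
      wins (kbar p k) (players p) (true ∷ lrMinimaBelow c (map (punchInℕ c) zs))
        ≡⟨ cong (λ t → wins (kbar p k) (players p) (true ∷ t)) (lrMinimaBelow-punchIn {c} ≤-refl zs) ⟩
      wins (kbar p k) (players p) (true ∷ lrMinimaBelow c zs)
        ∎
  larger : ∀ c → a ≤ c →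
    countPerms (suc m) (λ zs → Ψ (c ∷ map (punchInℕ c) zs)) ≡ countSecondEliminated (suc m) q k a
  larger c a≤c = countPerms-cong (suc m) λ zs →
    cong (λ t → wins k (players p) (true ∷ t))
         (trans (lrMinimaBelow-∷-≥ a≤c (map (punchInℕ c) zs)) (cong (false ∷_) (lrMinimaBelow-punchIn a≤c zs)))

onlyPlayer-∷ʳ : ∀ k x (ys : List ℕ) z → onlyPlayer k (x ∷ (ys ∷ʳ z)) ≡ false
onlyPlayer-∷ʳ k x [] z = refl
onlyPlayer-∷ʳ k x (y ∷ ys) z = refl

w-one-player : ∀ m k s → w (suc m) 1 k s ≡ 0
w-one-player m k s = trans (w≡countPerms (suc m) 1 k s) (countPerms-false (suc m) cannot-start)
  where
  cannot-start : ∀ xs → wins k (players 1) (lrMinima (λ _ → true) xs) ∧ startsWith s xs ≡ false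
  cannot-start [] = ∧-zeroʳ _
  cannot-start (x ∷ xs) = refl

wins-two-throws : ∀ q k b → wins k (players (3 + q)) (true ∷ b ∷ []) ≡ false
wins-two-throws q k true = onlyPlayer-∷ʳ k 3 (applyUpTo (4 +_) q ∷ʳ 1) 2
wins-two-throws q k false = onlyPlayer-∷ʳ k 3 (applyUpTo (4 +_) q) 1

w-two-many-players : ∀ q k s → w 2 (3 + q) k s ≡ 0
w-two-many-players q k s = trans (w≡countPerms 2 (3 + q) k s) (count-all-false unfinished (allVecs 2 2))
  where
  unfinished : (σ : Vec (Fin 2) 2) →
    distinct σ ∧ (wins k (players (3 + q)) (lrMinima (λ _ → true) (values σ)) ∧ startsWith s (values σ)) ≡ false
  unfinished (x ∷ y ∷ []) =
    trans (cong (λ c → distinct (x ∷ y ∷ []) ∧ (c ∧ startsWith s (values (x ∷ y ∷ []))))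
                (wins-two-throws q k (toℕ y <ᵇ toℕ x)))
          (∧-zeroʳ _)

w-two-vanishes : ∀ p k s → 1 ≤ k → k ≤ p → s ≤ 2 → ¬ (p ≡ 2 × k ≡ 1 × s ≡ 1) → w 2 p k s ≡ 0
w-two-vanishes 0 (suc _) _ _ () _ _
w-two-vanishes 1 k s _ _ _ _ = w-one-player 1 k s
w-two-vanishes 2 1 0 _ _ _ _ = refl
w-two-vanishes 2 1 1 _ _ _ excluded = ⊥-elim (excluded (refl , refl , refl))
w-two-vanishes 2 1 2 _ _ _ _ = refl
w-two-vanishes 2 2 0 _ _ _ _ = refl
w-two-vanishes 2 2 1 _ _ _ _ = refl
w-two-vanishes 2 2 2 _ _ _ _ = refl
w-two-vanishes 2 _ (suc (suc (suc _))) _ _ (s≤s (s≤s ())) _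
w-two-vanishes 2 (suc (suc (suc _))) _ _ (s≤s (s≤s ())) _ _
w-two-vanishes (suc (suc (suc q))) k s _ _ _ _ = w-two-many-players q k s

theorem4p8 :
    (w 2 2 1 1 ≡ 1)
    × ((n p k s : ℕ) → 2 ≤ n → 1 ≤ p → 1 ≤ k → k ≤ p → 1 ≤ s → s ≤ n →
        (p ≡ 1 ⊎ n ≡ 2) → ¬ (n ≡ 2 × p ≡ 2 × k ≡ 1 × s ≡ 1) → w n p k s ≡ 0)
    × ((n p k s : ℕ) → 3 ≤ n → 2 ≤ p → 1 ≤ k → k ≤ p → 1 ≤ s → s ≤ n →
        w n p k s ≡ sumTo s (λ s′ → w (n ∸ 1) p (kbar p k) s′) + secondTerm n p k s)
theorem4p8 = refl , vanishing , recurrence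
  where
  vanishing : (n p k s : ℕ) → 2 ≤ n → 1 ≤ p → 1 ≤ k → k ≤ p → 1 ≤ s → s ≤ n →
    (p ≡ 1 ⊎ n ≡ 2) → ¬ (n ≡ 2 × p ≡ 2 × k ≡ 1 × s ≡ 1) → w n p k s ≡ 0
  vanishing (suc m) p k s _ _ _ _ _ _ (inj₁ refl) _ = w-one-player m k s
  vanishing n p k s _ _ 1≤k k≤p _ s≤n (inj₂ refl) excluded =
    w-two-vanishes p k s 1≤k k≤p s≤n (λ (p≡2 , k≡1 , s≡1) → excluded (refl , p≡2 , k≡1 , s≡1))

  recurrence : (n p k s : ℕ) → 3 ≤ n → 2 ≤ p → 1 ≤ k → k ≤ p → 1 ≤ s → s ≤ n →
    w n p k s ≡ sumTo s (λ s′ → w (n ∸ 1) p (kbar p k) s′) + secondTerm n p k s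
  recurrence (suc (suc (suc m))) (suc (suc q)) k (suc a) (s≤s (s≤s (s≤s _))) (s≤s (s≤s _)) 1≤k k≤p _ (s≤s a≤) =
    w-recurrence m q k a 1≤k k≤p a≤
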